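{- Let $H$ be a $k$-graph and $d$ an integer with $1\le d<k-1$. Then $\delta^{\ast}_d(H)\ge\frac{\delta^{\ast}(H)}{k-d}\cdot\delta^{\ast}_{d+1}(H)$.
   Context: A $k$-graph $H$ has edges that are $k$-subsets of $V(H)$. For $S\subseteq V(H)$, $\deg_H(S)$ is the number of edges containing $S$; $S$ is supported if $\deg_H(S)>0$. For $1\le d<k$ and non-empty $H$, the minimum supported $d$-degree $\delta^{\ast}_d(H)$ is the largest integer $m$ such that every supported $d$-set has degree at least $m$; if $H$ is empty, $\delta^{\ast}_d(H)=0$. Also $\delta^{\ast}(H)=\delta^{\ast}_{k-1}(H)$. -}

module Defs where

open import Data.Nat using (ℕ; zero; suc; _≤_; _<_)
open import Data.Bool using (Bool; true; false; T)
open import Data.Bool.Properties using (T?)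
open import Data.List using (List; []; _∷_; _++_; map; length; filter)
open import Data.Vec using (_∷_) renaming ([] to []ᵥ)
open import Data.Fin.Subset using (Subset; inside; outside; ∣_∣; _⊆_)
open import Data.Fin.Subset.Properties using (_⊆?_)
open import Data.Product using (Σ; _×_; ∃)
open import Relation.Nullary.Decidable using (_×-dec_)
open import Relation.Binary.PropositionalEquality using (_≡_)

allSubsets : (n : ℕ) → List (Subset n)
allSubsets zero = []ᵥ ∷ []
allSubsets (suc n) = map (outside ∷_) (allSubsets n) ++ map (inside ∷_) (allSubsets n)

record KGraph (k : ℕ) : Set where
  field
    n       : ℕ
    E       : Subset n → Bool
    uniform : ∀ e → T (E e) → ∣ e ∣ ≡ k
open KGraph public

deg : ∀ {k} (H : KGraph k) → Subset (n H) → ℕ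
deg H S = length (filter (λ e → T? (E H e) ×-dec (S ⊆? e)) (allSubsets (n H)))

Supported : ∀ {k} (H : KGraph k) → Subset (n H) → Set
Supported H S = 0 < deg H S

EmptyGraph : ∀ {k} → KGraph k → Set
EmptyGraph H = ∀ e → E H e ≡ false

NonEmptyGraph : ∀ {k} → KGraph k → Set
NonEmptyGraph H = ∃ λ e → T (E H e)

SuppLowerBound : ∀ {k} (H : KGraph k) → ℕ → ℕ → Set
SuppLowerBound H d m = ∀ S → ∣ S ∣ ≡ d → Supported H S → m ≤ deg H S

-- m = δ*_d(H): the largest m such that every supported d-set has degree ≥ m
-- (for non-empty H), and 0 if H is empty
IsMinSuppDeg : ∀ {k} (H : KGraph k) (d m : ℕ) → Set
IsMinSuppDeg H d m =
  (EmptyGraph H → m ≡ 0) ×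
  (NonEmptyGraph H →
     SuppLowerBound H d m × (∀ m′ → SuppLowerBound H d m′ → m′ ≤ m))

{-# OPTIONS --safe #-}
module Submission where

-- Take a supported d-set S of minimum degree, an edge e ⊇ S and a vertex w ∈ e ∖ S.
-- Then R = e - w is a supported (k-1)-set containing S, so at least δ*(H) vertices v
-- extend R to an edge, and for each of them S ∪ {v} is a supported (d+1)-set, of degree
-- at least δ*_{d+1}(H).  Counting the pairs (f, v) with f an edge through S and v ∈ f ∖ S
-- in two ways gives (k - d) deg(S) = Σ_{v ∉ S} deg(S ∪ {v}) ≥ δ*(H) δ*_{d+1}(H).

open import Defs
open import Data.Bool using (true; false; T; if_then_else_)
open import Data.Bool.Properties using (T?; T-≡; ¬-not)
open import Data.Fin using (Fin; zero; suc)
open import Data.Fin.Subset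
open import Data.Fin.Subset.Properties
open import Data.List using (List; []; _∷_; map; length; filter)
open import Data.List.Properties using (filter-some; filter-≐)
open import Data.List.Membership.Propositional using (lose) renaming (_∈_ to _∈ₗ_)
open import Data.List.Membership.Propositional.Properties
  using (∈-map⁺; ∈-map⁻; ∈-++⁺ˡ; ∈-++⁺ʳ; ∈-filter⁻)
open import Data.List.Relation.Binary.Disjoint.Propositional using (Disjoint)
import Data.List.Relation.Binary.Sublist.Propositional as Sublist
import Data.List.Relation.Binary.Sublist.Propositional.Properties as Sublist
open import Data.List.Relation.Unary.All as All using (All; []; _∷_)
open import Data.List.Relation.Unary.All.Properties using (all-filter)
open import Data.List.Relation.Unary.AllPairs using ([]; _∷_)
open import Data.List.Relation.Unary.Any using (here; there)
open import Data.List.Relation.Unary.Unique.Propositional using (Unique)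
import Data.List.Relation.Unary.Unique.Propositional.Properties as Unique
open import Data.Nat
  using (ℕ; zero; suc; _+_; _*_; _∸_; _≤_; _<_; _⊓_; z≤n; s≤s; _≟_; _≤?_; _<?_)
open import Data.Nat.Properties
open import Algebra.Properties.Semiring.Sum +-*-semiring
  using (sum-syntax; sum-cong-≗; sum-replicate-zero; ∑-distrib-+; *-distribʳ-sum)
open import Data.Product using (_×_; _,_; ∃; proj₁; proj₂)
open import Data.Sum using (_⊎_; inj₁; inj₂)
open import Data.Vec using ([]; _∷_; here; there)
open import Data.Vec.Properties using (∷-injectiveʳ)
open import Function using (_∘_)
open import Function.Bundles using (_⇔_; mk⇔; Equivalence)
open import Relation.Binary.PropositionalEquality
open import Relation.Nullary using (Dec; does; yes; no; contradiction)
open import Relation.Nullary.Decidable using (_×-dec_)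
open import Relation.Unary using (Pred; Decidable; _≐_)
open import Relation.Unary.Properties using (_∩?_)

𝟙 : ∀ {p} {P : Set p} → Dec P → ℕ
𝟙 P? = if does P? then 1 else 0

∑-mono-≤ : ∀ {n} {f g : Fin n → ℕ} → (∀ i → f i ≤ g i) → ∑[ i < n ] f i ≤ ∑[ i < n ] g i
∑-mono-≤ {zero}  f≤g = z≤n
∑-mono-≤ {suc n} f≤g = +-mono-≤ (f≤g zero) (∑-mono-≤ (f≤g ∘ suc))

[m⊓1]*n≤m : ∀ m n → (0 < m → n ≤ m) → (m ⊓ 1) * n ≤ m
[m⊓1]*n≤m zero    n n≤m = z≤n
[m⊓1]*n≤m (suc m) n n≤m rewrite ⊓-zeroʳ m | +-identityʳ n = n≤m (s≤s z≤n)

module _ {a} {A : Set a} where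

  length-filter-∷ : ∀ {p} {P : Pred A p} (P? : Decidable P) x xs →
    length (filter P? (x ∷ xs)) ≡ 𝟙 (P? x) + length (filter P? xs)
  length-filter-∷ P? x xs with does (P? x)
  ... | true  = refl
  ... | false = refl

  filter-filter : ∀ {p q} {P : Pred A p} {Q : Pred A q} (P? : Decidable P) (Q? : Decidable Q) xs →
    filter Q? (filter P? xs) ≡ filter (P? ∩? Q?) xs
  filter-filter P? Q? []       = refl
  filter-filter P? Q? (x ∷ xs) with does (P? x)
  ... | false = filter-filter P? Q? xs
  ... | true with does (Q? x)
  ...   | true  = cong (x ∷_) (filter-filter P? Q? xs)
  ...   | false = filter-filter P? Q? xs

  length>0⇒∃∈ : ∀ (xs : List A) → 0 < length xs → ∃ (_∈ₗ xs)
  length>0⇒∃∈ (x ∷ _) _ = x , here refl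

  unique∧constant⇒length≤1 : ∀ {xs : List A} {y} →
    Unique xs → (∀ {x} → x ∈ₗ xs → x ≡ y) → length xs ≤ 1
  unique∧constant⇒length≤1 {[]}        _                ≡y = z≤n
  unique∧constant⇒length≤1 {_ ∷ []}    _                ≡y = ≤-refl
  unique∧constant⇒length≤1 {_ ∷ _ ∷ _} ((x≢x′ ∷ _) ∷ _) ≡y =
    contradiction (trans (≡y (here refl)) (sym (≡y (there (here refl))))) x≢x′

∑-𝟙-∈ : ∀ {n} (p : Subset n) → ∑[ v < n ] 𝟙 (v ∈? p) ≡ ∣ p ∣
∑-𝟙-∈ []            = refl
∑-𝟙-∈ (inside  ∷ p) = cong suc (∑-𝟙-∈ p)
∑-𝟙-∈ (outside ∷ p) = ∑-𝟙-∈ p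

∑-incidences : ∀ {a} {A : Set a} {n m} (f : A → Subset n) xs → All (λ x → ∣ f x ∣ ≡ m) xs →
  ∑[ v < n ] length (filter (λ x → v ∈? f x) xs) ≡ length xs * m
∑-incidences {n = n} f []       []                 = sum-replicate-zero n
∑-incidences {n = n} f (x ∷ xs) (∣fx∣≡m ∷ ∣fxs∣≡m) = begin
  ∑[ v < n ] length (filter (λ y → v ∈? f y) (x ∷ xs))
    ≡⟨ sum-cong-≗ (λ v → length-filter-∷ (λ y → v ∈? f y) x xs) ⟩
  ∑[ v < n ] (𝟙 (v ∈? f x) + length (filter (λ y → v ∈? f y) xs))
    ≡⟨ ∑-distrib-+ (λ v → 𝟙 (v ∈? f x)) _ ⟩
  ∑[ v < n ] 𝟙 (v ∈? f x) + ∑[ v < n ] length (filter (λ y → v ∈? f y) xs)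
    ≡⟨ cong₂ _+_ (trans (∑-𝟙-∈ (f x)) ∣fx∣≡m) (∑-incidences f xs ∣fxs∣≡m) ⟩
  suc (length xs) * _
    ∎
  where open ≡-Reasoning

∣p─q∣+∣q∣≡∣p∣ : ∀ {n} {p q : Subset n} → q ⊆ p → ∣ p ─ q ∣ + ∣ q ∣ ≡ ∣ p ∣
∣p─q∣+∣q∣≡∣p∣ {p = []}          {[]}          _   = refl
∣p─q∣+∣q∣≡∣p∣ {p = outside ∷ p} {outside ∷ q} q⊆p = ∣p─q∣+∣q∣≡∣p∣ (drop-∷-⊆ q⊆p)
∣p─q∣+∣q∣≡∣p∣ {p = inside  ∷ p} {outside ∷ q} q⊆p = cong suc (∣p─q∣+∣q∣≡∣p∣ (drop-∷-⊆ q⊆p))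
∣p─q∣+∣q∣≡∣p∣ {p = inside  ∷ p} {inside  ∷ q} q⊆p =
  trans (+-suc _ _) (cong suc (∣p─q∣+∣q∣≡∣p∣ (drop-∷-⊆ q⊆p)))
∣p─q∣+∣q∣≡∣p∣ {p = outside ∷ p} {inside  ∷ q} q⊆p = contradiction (q⊆p here) λ()

x∈p⇒suc∣p-x∣≡∣p∣ : ∀ {n} {x : Fin n} {p} → x ∈ p → suc ∣ p - x ∣ ≡ ∣ p ∣
x∈p⇒suc∣p-x∣≡∣p∣ {x = x} {p} x∈p = begin
  suc ∣ p - x ∣         ≡⟨ +-comm 1 ∣ p - x ∣ ⟩
  ∣ p - x ∣ + 1         ≡⟨ cong (∣ p - x ∣ +_) (∣⁅x⁆∣≡1 x) ⟨
  ∣ p - x ∣ + ∣ ⁅ x ⁆ ∣ ≡⟨ ∣p─q∣+∣q∣≡∣p∣ ⁅x⁆⊆p ⟩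
  ∣ p ∣                 ∎
  where
  open ≡-Reasoning
  ⁅x⁆⊆p : ⁅ x ⁆ ⊆ p
  ⁅x⁆⊆p y∈⁅x⁆ = subst (_∈ p) (sym (x∈⁅y⁆⇒x≡y x y∈⁅x⁆)) x∈p

x∉p⇒∣p∪⁅x⁆∣≡suc∣p∣ : ∀ {n} {x : Fin n} {p} → x ∉ p → ∣ p ∪ ⁅ x ⁆ ∣ ≡ suc ∣ p ∣
x∉p⇒∣p∪⁅x⁆∣≡suc∣p∣ {x = zero}  {outside ∷ p} _   = cong (suc ∘ ∣_∣) (∪-identityʳ p)
x∉p⇒∣p∪⁅x⁆∣≡suc∣p∣ {x = zero}  {inside  ∷ p} x∉p = contradiction here x∉p
x∉p⇒∣p∪⁅x⁆∣≡suc∣p∣ {x = suc x} {outside ∷ p} x∉p = x∉p⇒∣p∪⁅x⁆∣≡suc∣p∣ (x∉p ∘ there)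
x∉p⇒∣p∪⁅x⁆∣≡suc∣p∣ {x = suc x} {inside  ∷ p} x∉p =
  cong suc (x∉p⇒∣p∪⁅x⁆∣≡suc∣p∣ (x∉p ∘ there))

x∈p─q⇒x∉q : ∀ {n} {x : Fin n} {p q} → x ∈ p ─ q → x ∉ q
x∈p─q⇒x∉q {p = _ ∷ _} {_ ∷ _} (there x∈p─q) (there x∈q) = x∈p─q⇒x∉q x∈p─q x∈q

p∪⁅x⁆⊆q⇔ : ∀ {n} {x : Fin n} {p q} → p ∪ ⁅ x ⁆ ⊆ q ⇔ (p ⊆ q × x ∈ q)
p∪⁅x⁆⊆q⇔ {x = x} {p} {q} = mk⇔ split join
  where
  split : p ∪ ⁅ x ⁆ ⊆ q → p ⊆ q × x ∈ q
  split p∪⁅x⁆⊆q = p∪⁅x⁆⊆q ∘ p⊆p∪q ⁅ x ⁆ , p∪⁅x⁆⊆q (q⊆p∪q p ⁅ x ⁆ (x∈⁅x⁆ x))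
  join : p ⊆ q × x ∈ q → p ∪ ⁅ x ⁆ ⊆ q
  join (p⊆q , x∈q) y∈p∪⁅x⁆ with x∈p∪q⁻ p ⁅ x ⁆ y∈p∪⁅x⁆
  ... | inj₁ y∈p   = p⊆q y∈p
  ... | inj₂ y∈⁅x⁆ = subst (_∈ q) (sym (x∈⁅y⁆⇒x≡y x y∈⁅x⁆)) x∈q

p⊆q∧∣q∣≤∣p∣⇒p≡q : ∀ {n} {p q : Subset n} → p ⊆ q → ∣ q ∣ ≤ ∣ p ∣ → p ≡ q
p⊆q∧∣q∣≤∣p∣⇒p≡q {p = []}          {[]}          _   _ = refl
p⊆q∧∣q∣≤∣p∣⇒p≡q {p = outside ∷ p} {outside ∷ q} p⊆q ∣q∣≤∣p∣ =
  cong (outside ∷_) (p⊆q∧∣q∣≤∣p∣⇒p≡q (drop-∷-⊆ p⊆q) ∣q∣≤∣p∣)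
p⊆q∧∣q∣≤∣p∣⇒p≡q {p = inside  ∷ p} {inside  ∷ q} p⊆q (s≤s ∣q∣≤∣p∣) =
  cong (inside ∷_) (p⊆q∧∣q∣≤∣p∣⇒p≡q (drop-∷-⊆ p⊆q) ∣q∣≤∣p∣)
p⊆q∧∣q∣≤∣p∣⇒p≡q {p = outside ∷ p} {inside  ∷ q} p⊆q ∣q∣<∣p∣ =
  contradiction (p⊆q⇒∣p∣≤∣q∣ (drop-∷-⊆ p⊆q)) (<⇒≱ ∣q∣<∣p∣)
p⊆q∧∣q∣≤∣p∣⇒p≡q {p = inside  ∷ p} {outside ∷ q} p⊆q _ = contradiction (p⊆q here) λ()

0<∣p∣⇒Nonempty : ∀ {n} {p : Subset n} → 0 < ∣ p ∣ → Nonempty p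
0<∣p∣⇒Nonempty {n} {p} 0<∣p∣ with nonempty? p
... | yes p≢∅ = p≢∅
... | no  p≡∅ = contradiction (trans (cong ∣_∣ (Empty-unique p≡∅)) (∣⊥∣≡0 n)) (>⇒≢ 0<∣p∣)

allSubsets-complete : ∀ {n} (p : Subset n) → p ∈ₗ allSubsets n
allSubsets-complete []            = here refl
allSubsets-complete (outside ∷ p) = ∈-++⁺ˡ (∈-map⁺ (outside ∷_) (allSubsets-complete p))
allSubsets-complete (inside  ∷ p) = ∈-++⁺ʳ _ (∈-map⁺ (inside ∷_) (allSubsets-complete p))

allSubsets-unique : ∀ n → Unique (allSubsets n)
allSubsets-unique zero    = [] ∷ []
allSubsets-unique (suc n) = Unique.++⁺
  (Unique.map⁺ ∷-injectiveʳ (allSubsets-unique n))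
  (Unique.map⁺ ∷-injectiveʳ (allSubsets-unique n))
  heads-differ
  where
  heads-differ : Disjoint (map (outside ∷_) (allSubsets n)) (map (inside ∷_) (allSubsets n))
  heads-differ (∈outside , ∈inside)
    with ∈-map⁻ (outside ∷_) ∈outside | ∈-map⁻ (inside ∷_) ∈inside
  ... | _ , _ , refl | _ , _ , ()

module _ {k} (H : KGraph k) where

  through? : ∀ X → Decidable (λ e → T (E H e) × X ⊆ e)
  through? X e = T? (E H e) ×-dec (X ⊆? e)

  -- deg H X is definitionally length (edgesThrough X).
  edgesThrough : Subset (n H) → List (Subset (n H))
  edgesThrough X = filter (through? X) (allSubsets (n H))

  ∈-edgesThrough⁻ : ∀ {X e} → e ∈ₗ edgesThrough X → T (E H e) × X ⊆ e
  ∈-edgesThrough⁻ {X} = proj₂ ∘ ∈-filter⁻ (through? X) {xs = allSubsets (n H)}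

  supported⁺ : ∀ {X e} → T (E H e) → X ⊆ e → Supported H X
  supported⁺ {X} {e} e∈E X⊆e =
    filter-some (through? X)
      (lose {P = λ e → T (E H e) × X ⊆ e} (allSubsets-complete e) (e∈E , X⊆e))

  supported⁻ : ∀ {X} → Supported H X → ∃ λ e → T (E H e) × X ⊆ e
  supported⁻ {X} X-supp with e , e∈ ← length>0⇒∃∈ (edgesThrough X) X-supp = e , ∈-edgesThrough⁻ e∈

  ∣e─X∣≡k∸∣X∣ : ∀ {X e} → T (E H e) → X ⊆ e → ∣ e ─ X ∣ ≡ k ∸ ∣ X ∣
  ∣e─X∣≡k∸∣X∣ {X} {e} e∈E X⊆e = begin
    ∣ e ─ X ∣                 ≡⟨ m+n∸n≡m _ ∣ X ∣ ⟨
    ∣ e ─ X ∣ + ∣ X ∣ ∸ ∣ X ∣ ≡⟨ cong (_∸ ∣ X ∣) (∣p─q∣+∣q∣≡∣p∣ X⊆e) ⟩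
    ∣ e ∣ ∸ ∣ X ∣             ≡⟨ cong (_∸ ∣ X ∣) (uniform H e e∈E) ⟩
    k ∸ ∣ X ∣                 ∎
    where open ≡-Reasoning

  linkDeg : Subset (n H) → Fin (n H) → ℕ
  linkDeg X v = length (filter (λ e → v ∈? e ─ X) (edgesThrough X))

  ∑-linkDeg : ∀ X → ∑[ v < n H ] linkDeg X v ≡ deg H X * (k ∸ ∣ X ∣)
  ∑-linkDeg X = ∑-incidences (_─ X) (edgesThrough X)
    (All.map (λ (e∈E , X⊆e) → ∣e─X∣≡k∸∣X∣ e∈E X⊆e) (all-filter (through? X) (allSubsets (n H))))

  linkDeg-∉ : ∀ {X v} → v ∉ X → linkDeg X v ≡ deg H (X ∪ ⁅ v ⁆)
  linkDeg-∉ {X} {v} v∉X = cong length (trans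
    (filter-filter (through? X) (λ e → v ∈? e ─ X) (allSubsets (n H)))
    (filter-≐ _ (through? (X ∪ ⁅ v ⁆)) (to , from) (allSubsets (n H))))
    where
    to : ∀ {e} → (T (E H e) × X ⊆ e) × v ∈ e ─ X → T (E H e) × X ∪ ⁅ v ⁆ ⊆ e
    to ((e∈E , X⊆e) , v∈e─X) = e∈E , Equivalence.from p∪⁅x⁆⊆q⇔ (X⊆e , p─q⊆p _ X v∈e─X)
    from : ∀ {e} → T (E H e) × X ∪ ⁅ v ⁆ ⊆ e → (T (E H e) × X ⊆ e) × v ∈ e ─ X
    from (e∈E , X∪v⊆e) with X⊆e , v∈e ← Equivalence.to p∪⁅x⁆⊆q⇔ X∪v⊆e =
      (e∈E , X⊆e) , x∈p∧x∉q⇒x∈p─q v∈e v∉X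

  linkDeg>0⇒∉ : ∀ {X v} → 0 < linkDeg X v → v ∉ X
  linkDeg>0⇒∉ {X} {v} v-linked
    with _ , e∈ ← length>0⇒∃∈ (filter (λ e → v ∈? e ─ X) (edgesThrough X)) v-linked =
    x∈p─q⇒x∉q (proj₂ (∈-filter⁻ (λ e → v ∈? e ─ X) {xs = edgesThrough X} e∈))

  linkDeg-antitone : ∀ {X Y} v → X ⊆ Y → linkDeg Y v ≤ linkDeg X v
  linkDeg-antitone {X} {Y} v X⊆Y = Sublist.length-mono-≤
    (Sublist.filter⁺ (λ e → v ∈? e ─ Y) (λ e → v ∈? e ─ X) outside-Y⇒outside-X
      (Sublist.filter⁺ (through? Y) (through? X) through-Y⇒through-X
        (Sublist.⊆-refl {x = allSubsets (n H)})))
    where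
    through-Y⇒through-X : ∀ {e e′} → e ≡ e′ → T (E H e) × Y ⊆ e → T (E H e′) × X ⊆ e′
    through-Y⇒through-X refl (e∈E , Y⊆e) = e∈E , ⊆-trans X⊆Y Y⊆e
    outside-Y⇒outside-X : ∀ {e e′} → e ≡ e′ → v ∈ e ─ Y → v ∈ e′ ─ X
    outside-Y⇒outside-X refl v∈e─Y =
      x∈p∧x∉q⇒x∈p─q (p─q⊆p _ Y v∈e─Y) (x∈p─q⇒x∉q v∈e─Y ∘ X⊆Y)

  -- An edge through a (k-1)-set X and a vertex v ∉ X can only be X ∪ ⁅ v ⁆.
  linkDeg≤1 : ∀ {X} v → suc ∣ X ∣ ≡ k → linkDeg X v ≤ 1
  linkDeg≤1 {X} v suc∣X∣≡k = unique∧constant⇒length≤1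
    (Unique.filter⁺ (λ e → v ∈? e ─ X) (Unique.filter⁺ (through? X) (allSubsets-unique (n H))))
    ≡X∪v
    where
    ≡X∪v : ∀ {e} → e ∈ₗ filter (λ e → v ∈? e ─ X) (edgesThrough X) → e ≡ X ∪ ⁅ v ⁆
    ≡X∪v {e} e∈ with e∈′ , v∈e─X ← ∈-filter⁻ (λ e → v ∈? e ─ X) {xs = edgesThrough X} e∈
                  with e∈E , X⊆e ← ∈-edgesThrough⁻ e∈′ =
      sym (p⊆q∧∣q∣≤∣p∣⇒p≡q (Equivalence.from p∪⁅x⁆⊆q⇔ (X⊆e , p─q⊆p e X v∈e─X)) (≤-reflexive (begin
        ∣ e ∣             ≡⟨ uniform H e e∈E ⟩
        k                 ≡⟨ suc∣X∣≡k ⟨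
        suc ∣ X ∣         ≡⟨ x∉p⇒∣p∪⁅x⁆∣≡suc∣p∣ (x∈p─q⇒x∉q v∈e─X) ⟨
        ∣ X ∪ ⁅ v ⁆ ∣     ∎)))
      where open ≡-Reasoning

  linkDeg-lowerBound : ∀ {X v b} → SuppLowerBound H (suc ∣ X ∣) b → 0 < linkDeg X v →
    b ≤ linkDeg X v
  linkDeg-lowerBound {X} {v} bound v-linked = subst (_ ≤_) (sym linkDeg≡deg)
    (bound (X ∪ ⁅ v ⁆) (x∉p⇒∣p∪⁅x⁆∣≡suc∣p∣ v∉X) (subst (0 <_) linkDeg≡deg v-linked))
    where
    v∉X : v ∉ X
    v∉X = linkDeg>0⇒∉ v-linked
    linkDeg≡deg : linkDeg X v ≡ deg H (X ∪ ⁅ v ⁆)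
    linkDeg≡deg = linkDeg-∉ v∉X

  supported-extend : ∀ {S} → Supported H S → ∣ S ∣ < k →
    ∃ λ R → S ⊆ R × suc ∣ R ∣ ≡ k × Supported H R
  supported-extend {S} S-supp ∣S∣<k
    with e , e∈E , S⊆e ← supported⁻ S-supp
    with w , w∈e─S ← 0<∣p∣⇒Nonempty (subst (0 <_) (sym (∣e─X∣≡k∸∣X∣ e∈E S⊆e)) (m<n⇒0<n∸m ∣S∣<k)) =
    e - w , S⊆e-w , trans (x∈p⇒suc∣p-x∣≡∣p∣ w∈e) (uniform H e e∈E) , supported⁺ e∈E (p─q⊆p e ⁅ w ⁆)
    where
    w∈e : w ∈ e
    w∈e = p─q⊆p e S w∈e─S
    S⊆e-w : S ⊆ e - w
    S⊆e-w x∈S = x∈p∧x≢y⇒x∈p-y (S⊆e x∈S) λ { refl → x∈p─q⇒x∉q w∈e─S x∈S }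

  supported-deg-bound : ∀ {S b c} →
    SuppLowerBound H (suc ∣ S ∣) b → SuppLowerBound H (k ∸ 1) c → ∣ S ∣ < k → Supported H S →
    c * b ≤ deg H S * (k ∸ ∣ S ∣)
  supported-deg-bound {S} {b} {c} b-bound c-bound ∣S∣<k S-supp
    with R , S⊆R , suc∣R∣≡k , R-supp ← supported-extend S-supp ∣S∣<k = begin
    c * b                                ≤⟨ *-monoˡ-≤ b (c-bound R (cong (_∸ 1) suc∣R∣≡k) R-supp) ⟩
    deg H R * b                          ≡⟨ cong (_* b) degR≡∑ ⟩
    (∑[ v < n H ] linkDeg R v) * b       ≤⟨ *-monoˡ-≤ b (∑-mono-≤ λ v →
                                             ⊓-glb (linkDeg-antitone v S⊆R) (linkDeg≤1 v suc∣R∣≡k)) ⟩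
    (∑[ v < n H ] (linkDeg S v ⊓ 1)) * b ≡⟨ *-distribʳ-sum b (λ v → linkDeg S v ⊓ 1) ⟩
    ∑[ v < n H ] ((linkDeg S v ⊓ 1) * b) ≤⟨ ∑-mono-≤ (λ v →
                                             [m⊓1]*n≤m _ b (linkDeg-lowerBound {S} {v} b-bound)) ⟩
    ∑[ v < n H ] linkDeg S v             ≡⟨ ∑-linkDeg S ⟩
    deg H S * (k ∸ ∣ S ∣)                ∎
    where
    open ≤-Reasoning
    k∸∣R∣≡1 : k ∸ ∣ R ∣ ≡ 1
    k∸∣R∣≡1 = trans (cong (_∸ ∣ R ∣) (sym suc∣R∣≡k)) (m+n∸n≡m 1 ∣ R ∣)
    degR≡∑ : deg H R ≡ ∑[ v < n H ] linkDeg R v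
    degR≡∑ = begin-equality
      deg H R                  ≡⟨ *-identityʳ _ ⟨
      deg H R * 1              ≡⟨ cong (deg H R *_) k∸∣R∣≡1 ⟨
      deg H R * (k ∸ ∣ R ∣)    ≡⟨ ∑-linkDeg R ⟨
      ∑[ v < n H ] linkDeg R v ∎

  empty⊎nonEmpty : EmptyGraph H ⊎ NonEmptyGraph H
  empty⊎nonEmpty with anySubset? (λ e → T? (E H e))
  ... | yes nonEmpty  = inj₂ nonEmpty
  ... | no  ¬nonEmpty = inj₁ λ e → ¬-not λ e∈E → ¬nonEmpty (e , Equivalence.from T-≡ e∈E)

  maxLowerBound-attained : ∀ {d m} → (∀ m′ → SuppLowerBound H d m′ → m′ ≤ m) →
    ∃ λ S → ∣ S ∣ ≡ d × Supported H S × deg H S ≤ m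
  maxLowerBound-attained {d} {m} maximal
    with anySubset? (λ S → (∣ S ∣ ≟ d) ×-dec (0 <? deg H S) ×-dec (deg H S ≤? m))
  ... | yes witness = witness
  ... | no  ∄S      = contradiction (maximal (suc m) suc-m-bound) 1+n≰n
    where
    suc-m-bound : SuppLowerBound H d (suc m)
    suc-m-bound S ∣S∣≡d S-supp = ≰⇒> λ degS≤m → ∄S (S , ∣S∣≡d , S-supp , degS≤m)

fact3p4 : ∀ {k} (H : KGraph k) (d : ℕ) → 1 ≤ d → d + 1 < k →
    ∀ a b c → IsMinSuppDeg H d a → IsMinSuppDeg H (suc d) b →
    IsMinSuppDeg H (k ∸ 1) c →
    c * b ≤ (k ∸ d) * a
fact3p4 {k} H d _ d+1<k a b c (_ , a-min) (_ , b-min) (c-empty , c-min) with empty⊎nonEmpty H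
... | inj₁ empty rewrite c-empty empty = z≤n
... | inj₂ nonEmpty
  with S , refl , S-supp , degS≤a ← maxLowerBound-attained H (proj₂ (a-min nonEmpty)) = begin
  c * b             ≤⟨ supported-deg-bound H (proj₁ (b-min nonEmpty)) (proj₁ (c-min nonEmpty))
                         (m+n≤o⇒m≤o (suc d) d+1<k) S-supp ⟩
  deg H S * (k ∸ d) ≡⟨ *-comm (deg H S) (k ∸ d) ⟩
  (k ∸ d) * deg H S ≤⟨ *-monoʳ-≤ (k ∸ d) degS≤a ⟩
  (k ∸ d) * a       ∎
  where open ≤-Reasoning
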